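{- Let $\mathcal{M}$ be an $\mathit{LTL}$-model, $n$ a natural number, and $A$ an $\mathit{LTL}$-formula. Then $\mathcal{M},n\models_{\mathit{LTL}} A$ if and only if $\mathcal{M},[n]\models_{\nabla} A^*$.
   Context: Fix a set $\mathcal{P}$ of propositional symbols. $\mathit{LTL}$-formulas: $A ::= p \mid \bot \mid A\supset A \mid \mathsf{G}A \mid \mathsf{X}A \mid A\,\mathsf{U}\,A$ ($p\in\mathcal{P}$). $\mathit{LTL}_\nabla$-formulas: $A ::= p \mid \bot \mid A\supset A \mid \mathsf{G}A \mid \mathsf{X}A \mid \nabla A$. In both languages $\neg A := A\supset\bot$, $A\vee B := \neg A\supset B$, $A\wedge B := \neg(\neg A\vee\neg B)$, $\mathsf{F}A := \neg\mathsf{G}\neg A$. An $\mathit{LTL}$-model is $\mathcal{M}=\langle \mathbb{N},\mathcal{V}\rangle$ with $\mathcal{V}:\mathbb{N}\to 2^{\mathcal{P}}$. $\mathit{LTL}$-truth: $\mathcal{M},n\models_{\mathit{LTL}} p$ iff $p\in\mathcal{V}(n)$; $\bot$ never true; $\supset$ classical; $\mathcal{M},n\models_{\mathit{LTL}}\mathsf{G}A$ iff $\mathcal{M},m\models_{\mathit{LTL}} A$ for all $m\ge n$; $\mathcal{M},n\models_{\mathit{LTL}}\mathsf{X}A$ iff $\mathcal{M},n+1\models_{\mathit{LTL}} A$; $\mathcal{M},n\models_{\mathit{LTL}} A\,\mathsf{U}\,B$ iff there is $n'\ge n$ with $\mathcal{M},n'\models_{\mathit{LTL}} B$ and $\mathcal{M},m\models_{\mathit{LTL}}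 A$ for all $n\le m<n'$. An observation sequence is a non-empty finite sequence $[n_0,\ldots,n_k]$ of natural numbers. Truth $\models_\nabla$ of $\mathit{LTL}_\nabla$-formulas at observation sequences: $\mathcal{M},[n_0,\ldots,n_k]\models_\nabla p$ iff $p\in\mathcal{V}(n_k)$; $\bot$ never true; $\supset$ classical at the same sequence; $\mathcal{M},[n_0,\ldots,n_k]\models_\nabla\mathsf{G}A$ iff $\mathcal{M},[n_0,\ldots,n_k,m]\models_\nabla A$ for all $m\ge n_k$; $\mathcal{M},[n_0,\ldots,n_k]\models_\nabla\mathsf{X}A$ iff $\mathcal{M},[n_0,\ldots,n_k,n_k+1]\models_\nabla A$; if $k>0$, $\mathcal{M},[n_0,\ldots,n_{k-1},n_k]\models_\nabla\nabla A$ iff $\mathcal{M},[n_0,\ldots,n_{k-1},m]\models_\nabla A$ for all $n_{k-1}\le m\le n_k$; and $\mathcal{M},[n_0]\models_\nabla\nabla A$ iff $\mathcal{M},[n_0]\models_\nabla A$. The translation $(\cdot)^*$: $p^*=p$, $\bot^*=\bot$, $(A\supset B)^*=A^*\supset B^*$, $(\mathsf{G}A)^*=\mathsf{G}A^*$, $(\mathsf{X}A)^*=\mathsf{X}A^*$, $(A\,\mathsf{U}\,B)^* = B^*\vee \mathsf{F}(\mathsf{X}B^*\wedge\nabla A^*)$. -}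

module Defs where

open import Level using (Level; _⊔_; suc)
open import Data.Nat using (ℕ; _≤_; _+_)
open import Data.Empty using (⊥)
open import Data.List using (List; []; _∷_)
open import Data.List.NonEmpty using (List⁺; _∷_)
open import Data.Product using (_×_)

data LTL {a} (P : Set a) : Set a where
  var  : P → LTL P
  ⊥'   : LTL P
  _⊃_  : LTL P → LTL P → LTL P
  G    : LTL P → LTL P
  X    : LTL P → LTL P
  _U_  : LTL P → LTL P → LTL P

data LTL∇ {a} (P : Set a) : Set a where
  var  : P → LTL∇ P
  ⊥'   : LTL∇ P
  _⊃_  : LTL∇ P → LTL∇ P → LTL∇ P
  G    : LTL∇ P → LTL∇ P
  X    : LTL∇ P → LTL∇ P
  ∇    : LTL∇ P → LTL∇ P

module _ {a} {P : Set a} where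
  ¬∇ : LTL∇ P → LTL∇ P
  ¬∇ A = A ⊃ ⊥'

  _∨∇_ : LTL∇ P → LTL∇ P → LTL∇ P
  A ∨∇ B = ¬∇ A ⊃ B

  _∧∇_ : LTL∇ P → LTL∇ P → LTL∇ P
  A ∧∇ B = ¬∇ (¬∇ A ∨∇ ¬∇ B)

  F∇ : LTL∇ P → LTL∇ P
  F∇ A = ¬∇ (G (¬∇ A))

-- An LTL-model ⟨ℕ, V⟩ is given by its valuation V : ℕ → 2^P,
-- represented as a membership predicate.
Model : (P : Set) → Set₁
Model P = ℕ → P → Set

_,_⊨LTL_ : {P : Set} → Model P → ℕ → LTL P → Set
M , n ⊨LTL var p = M n p
M , n ⊨LTL ⊥' = Data.Empty.⊥ where import Data.Empty
M , n ⊨LTL (A ⊃ B) = M , n ⊨LTL A → M , n ⊨LTL B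
M , n ⊨LTL G A = ∀ m → n ≤ m → M , m ⊨LTL A
M , n ⊨LTL X A = M , (n + 1) ⊨LTL A
M , n ⊨LTL (A U B) =
  Σ ℕ (λ n' → n ≤ n' × M , n' ⊨LTL B × (∀ m → n ≤ m → m Data.Nat.< n' → M , m ⊨LTL A))
  where open import Data.Product using (Σ)
        import Data.Nat

-- Observation sequences [n₀,…,nₖ] are represented REVERSED as non-empty
-- lists nₖ ∷ [nₖ₋₁, …, n₀]: the head is the last (current) observation.
Obs : Set
Obs = List⁺ ℕ

push : ℕ → Obs → Obs
push m (h ∷ t) = m ∷ (h ∷ t)

_,_⊨∇_ : {P : Set} → Model P → Obs → LTL∇ P → Set
M , (nk ∷ rest) ⊨∇ var p = M nk p
M , σ ⊨∇ ⊥' = Data.Empty.⊥ where import Data.Empty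
M , σ ⊨∇ (A ⊃ B) = M , σ ⊨∇ A → M , σ ⊨∇ B
M , (nk ∷ rest) ⊨∇ G A = ∀ m → nk ≤ m → M , (m ∷ (nk ∷ rest)) ⊨∇ A
M , (nk ∷ rest) ⊨∇ X A = M , ((nk + 1) ∷ (nk ∷ rest)) ⊨∇ A
M , (nk ∷ []) ⊨∇ ∇ A = M , (nk ∷ []) ⊨∇ A
M , (nk ∷ (nk-1 ∷ rest)) ⊨∇ ∇ A =
  ∀ m → nk-1 ≤ m → m ≤ nk → M , (m ∷ (nk-1 ∷ rest)) ⊨∇ A

_* : ∀ {a} {P : Set a} → LTL P → LTL∇ P
(var p) * = var p
⊥' * = ⊥'
(A ⊃ B) * = (A *) ⊃ (B *)
(G A) * = G (A *)
(X A) * = X (A *)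
(A U B) * = (B *) ∨∇ F∇ (X (B *) ∧∇ ∇ (A *))

[_]ₒ : ℕ → Obs
[ n ]ₒ = n ∷ []

-- The value of A* at an observation sequence depends only on its last
-- observation, where it agrees with the LTL value of A; this is proved for
-- an arbitrary history, by induction on A. The only real case is Until:
-- ∇ quantifies over the interval between the last two observations, so
-- F (X B* ∧ ∇ A*) at [n] says that B holds at m + 1 and A holds on [n, m]
-- for some m ≥ n, and together with the disjunct B* this is the classical
-- unfolding of A U B. Excluded middle is needed because ∨, ∧ and F are
-- encoded through ⊃ and ⊥.
module Submission where

open import Defs
import Level
open import Data.Nat using (ℕ; suc; _≤_; _+_; s≤s)
open import Data.Nat.Properties using (+-comm; ≤-refl; ≤-pred; ≤⇒≯; m≤n⇒m≤1+n; m≤n⇒m<n∨m≡n)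
open import Data.Product using (_×_; _,_; ∃-syntax)
open import Data.Product.Function.NonDependent.Propositional using (_×-⇔_)
open import Data.Product.Function.Dependent.Propositional using (congˡ)
open import Data.Sum using (_⊎_; inj₁; inj₂)
open import Data.Sum.Function.Propositional using (_⊎-⇔_)
open import Data.List using (List; []; _∷_)
open import Data.List.NonEmpty using (_∷_)
open import Data.Empty using (⊥-elim)
open import Relation.Nullary using (yes; no; contradiction)
open import Relation.Binary.PropositionalEquality using (refl; subst)
open import Function.Bundles using (_⇔_; mk⇔; Equivalence)
open import Function.Construct.Identity using (⇔-id)
open import Function.Construct.Composition using (_⇔-∘_)
open import Function.Construct.Symmetry using (⇔-sym)
open import Function.Related.TypeIsomorphisms using (→-cong-⇔)
open import Axiom.ExcludedMiddle using (ExcludedMiddle)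
open import Axiom.DoubleNegationElimination using (em⇒dne)

∀-cong-⇔ : ∀ {a b c} {I : Set a} {A : I → Set b} {B : I → Set c} →
           (∀ i → A i ⇔ B i) → (∀ i → A i) ⇔ (∀ i → B i)
∀-cong-⇔ A⇔B = mk⇔ (λ f i → Equivalence.to (A⇔B i) (f i))
                   (λ g i → Equivalence.from (A⇔B i) (g i))

module _ {P : Set} (M : Model P) where

  -- B is taken at m + 1 in the form X B at m, which is how the translation
  -- of A U B sees it.
  until-unfold : ∀ (A B : LTL P) {h} →
                 M , h ⊨LTL (A U B) ⇔
                 (M , h ⊨LTL B ⊎
                  ∃[ m ] (h ≤ m × M , m ⊨LTL X B × (∀ k → h ≤ k → k ≤ m → M , k ⊨LTL A)))
  until-unfold A B {h} = mk⇔ to from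
    where
    Unfolded : Set
    Unfolded = M , h ⊨LTL B ⊎
               ∃[ m ] (h ≤ m × M , m ⊨LTL X B × (∀ k → h ≤ k → k ≤ m → M , k ⊨LTL A))

    to : M , h ⊨LTL (A U B) → Unfolded
    to (n , h≤n , b , as) with m≤n⇒m<n∨m≡n h≤n
    ... | inj₂ refl = inj₁ b
    ... | inj₁ (s≤s h≤m) =
      inj₂ (_ , h≤m , subst (M ,_⊨LTL B) (+-comm 1 _) b , λ k h≤k k≤m → as k h≤k (s≤s k≤m))

    from : Unfolded → M , h ⊨LTL (A U B)
    from (inj₁ b) = h , ≤-refl , b , λ k h≤k k<h → contradiction k<h (≤⇒≯ h≤k)
    from (inj₂ (m , h≤m , b , as)) =
      suc m , m≤n⇒m≤1+n h≤m , subst (M ,_⊨LTL B) (+-comm m 1) b ,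
      λ k h≤k k<1+m → as k h≤k (≤-pred k<1+m)

  module _ (em : ExcludedMiddle Level.zero) where

    ∨∇-⇔ : ∀ {σ} (A B : LTL∇ P) → M , σ ⊨∇ (A ∨∇ B) ⇔ (M , σ ⊨∇ A ⊎ M , σ ⊨∇ B)
    ∨∇-⇔ {σ} A B = mk⇔ to from
      where
      to : M , σ ⊨∇ (A ∨∇ B) → M , σ ⊨∇ A ⊎ M , σ ⊨∇ B
      to f with em {M , σ ⊨∇ A}
      ... | yes a = inj₁ a
      ... | no ¬a = inj₂ (f ¬a)
      from : M , σ ⊨∇ A ⊎ M , σ ⊨∇ B → M , σ ⊨∇ (A ∨∇ B)
      from (inj₁ a) ¬a = contradiction a ¬a
      from (inj₂ b) _ = b

    ∧∇-⇔ : ∀ {σ} (A B : LTL∇ P) → M , σ ⊨∇ (A ∧∇ B) ⇔ (M , σ ⊨∇ A × M , σ ⊨∇ B)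
    ∧∇-⇔ A B = mk⇔ (λ f → em⇒dne em (λ ¬a → f (λ ¬¬a → ⊥-elim (¬¬a ¬a))) ,
                          em⇒dne em (λ ¬b → f (λ _ → ¬b)))
                   (λ (a , b) f → f (λ ¬a → ¬a a) b)

    F∇-⇔ : ∀ {h r} (A : LTL∇ P) → M , (h ∷ r) ⊨∇ F∇ A ⇔ (∃[ m ] (h ≤ m × M , (m ∷ h ∷ r) ⊨∇ A))
    F∇-⇔ A = mk⇔ (λ f → em⇒dne em (λ ∄ → f (λ m h≤m a → ∄ (m , h≤m , a))))
                 (λ (m , h≤m , a) g → g m h≤m a)

    until*-unfold : ∀ (A B : LTL∇ P) {h r} →
                    M , (h ∷ r) ⊨∇ (B ∨∇ F∇ (X B ∧∇ ∇ A)) ⇔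
                    (M , (h ∷ r) ⊨∇ B ⊎
                     ∃[ m ] (h ≤ m × M , (m ∷ h ∷ r) ⊨∇ X B × (∀ k → h ≤ k → k ≤ m → M , (k ∷ h ∷ r) ⊨∇ A)))
    until*-unfold A B =
      (⇔-id _ ⊎-⇔ congˡ (⇔-id _ ×-⇔ ∧∇-⇔ (X B) (∇ A)) ⇔-∘ F∇-⇔ (X B ∧∇ ∇ A))
      ⇔-∘ ∨∇-⇔ B (F∇ (X B ∧∇ ∇ A))

    translation-correct : ∀ (A : LTL P) h (r : List ℕ) → M , h ⊨LTL A ⇔ M , (h ∷ r) ⊨∇ (A *)
    translation-correct (var p) h r = ⇔-id _
    translation-correct ⊥' h r = ⇔-id _
    translation-correct (A ⊃ B) h r = →-cong-⇔ (translation-correct A h r) (translation-correct B h r)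
    translation-correct (G A) h r = ∀-cong-⇔ λ m → →-cong-⇔ (⇔-id _) (translation-correct A m (h ∷ r))
    translation-correct (X A) h r = translation-correct A (h + 1) (h ∷ r)
    translation-correct (A U B) h r =
      ⇔-sym (until*-unfold (A *) (B *)) ⇔-∘
      ((translation-correct B h r ⊎-⇔ congˡ λ {m} →
          ⇔-id _ ×-⇔ translation-correct B (m + 1) (m ∷ h ∷ r) ×-⇔
          ∀-cong-⇔ λ k → →-cong-⇔ (⇔-id _) (→-cong-⇔ (⇔-id _) (translation-correct A k (h ∷ r))))
       ⇔-∘ until-unfold A B)

lemma2 : {P : Set} → ExcludedMiddle Level.zero →
         (M : Model P) (n : ℕ) (A : LTL P) →
         (M , n ⊨LTL A) ⇔ (M , [ n ]ₒ ⊨∇ (A *))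
lemma2 em M n A = translation-correct M em A n []
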